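{- Let $d$ be a positive integer with binary representation $d = 2^{k_1} + 2^{k_2} + \cdots + 2^{k_r}$, $k_1 > k_2 > \cdots > k_r \ge 0$. Define $s_1 = \lceil k_1/2 \rceil$ and $s_i = \min(\lceil k_i/2\rceil, s_{i-1}-1)$ for $i = 2, \ldots, r$. Then $$w(\mathcal{C}(d)) = \sum_{i=1}^r \binom{k_i}{s_i}.$$
   Context: The binary order on subsets of $[n]$: $A <_b B$ if $\max(A \triangle B) \in B$. For $d \le 2^n$, $\mathcal{C}(d)$ denotes the set of the first $d$ subsets of $[n]$ in the binary order (this family does not depend on the choice of $n$ with $2^n \ge d$). The width $w(\mathcal{X})$ is the maximum size of an antichain (with respect to inclusion) in $\mathcal{X}$. Convention: $\binom{k}{s} = 0$ if $s<0$. -}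

module Defs where

open import Data.Bool using (Bool; true; false)
open import Data.Nat using (ℕ; zero; suc; _+_; _<_; _^_; ⌈_/2⌉)
open import Data.Nat.Combinatorics using (_C_)
open import Data.Integer as ℤ using (ℤ; +_; -[1+_]; _⊓_; _-_)
open import Data.Fin using (Fin; _<?_)
import Data.Fin as Fin
open import Data.Fin.Properties using (any?; all?)
open import Data.Fin.Subset using (Subset; _⊆_)
open import Data.Vec using (Vec; []; _∷_; lookup)
open import Data.List using (List; []; _∷_; _++_; map; filter; length)
open import Data.Nat.ListAction using (sum)
open import Data.List.Relation.Unary.All using (All)
open import Data.List.Relation.Unary.AllPairs using (AllPairs)
open import Data.List.Relation.Unary.Unique.Propositional using (Unique)
open import Data.Product using (∃; _×_; _,_)
open import Relation.Binary.PropositionalEquality using (_≡_)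
open import Relation.Nullary using (¬_; Dec)
open import Relation.Nullary.Decidable using (_×-dec_; _→-dec_)
open import Data.Bool.Properties using () renaming (_≟_ to _≟B_)

-- A subset A of [n] is a Vec Bool n; position i : Fin n stands for the
-- element (toℕ i + 1) of [n].

-- Binary order: A <b B iff max(A △ B) ∈ B, i.e. there is a position i with
-- i ∉ A, i ∈ B, and A, B agree at every position above i.
_<b_ : ∀ {n} → Subset n → Subset n → Set
_<b_ {n} A B = ∃ λ (i : Fin n) →
  (lookup A i ≡ false) × (lookup B i ≡ true) ×
  (∀ (j : Fin n) → i Fin.< j → lookup A j ≡ lookup B j)

_<b?_ : ∀ {n} (A B : Subset n) → Dec (A <b B)
A <b? B = any? λ i → (lookup A i ≟B false) ×-dec ((lookup B i ≟B true) ×-dec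
            all? (λ j → (i <? j) →-dec (lookup A j ≟B lookup B j)))

allSubsets : (n : ℕ) → List (Subset n)
allSubsets zero = [] ∷ []
allSubsets (suc n) = map (false ∷_) (allSubsets n) ++ map (true ∷_) (allSubsets n)

rank : ∀ {n} → Subset n → ℕ
rank {n} A = length (filter (λ B → B <b? A) (allSubsets n))

-- A ∈ 𝒞(d): A is among the first d subsets of [n] in the binary order.
InC : ∀ {n} → ℕ → Subset n → Set
InC d A = rank A < d

IsAntichainInC : ∀ {n} → ℕ → List (Subset n) → Set
IsAntichainInC d L =
  Unique L × All (InC d) L × AllPairs (λ A B → ¬ (A ⊆ B) × ¬ (B ⊆ A)) L

WidthC : (n d w : ℕ) → Set
WidthC n d w =
  (∃ λ (L : List (Subset n)) → IsAntichainInC d L × length L ≡ w) ×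
  (∀ (L : List (Subset n)) → IsAntichainInC d L → length L Data.Nat.≤ w)

binomℤ : ℕ → ℤ → ℕ
binomℤ k (+ s) = k C s
binomℤ k -[1+ _ ] = 0

tailSum : ℤ → List ℕ → ℕ
tailSum prev [] = 0
tailSum prev (k ∷ ks) =
  let s = (+ ⌈ k /2⌉) ⊓ (prev - + 1) in binomℤ k s + tailSum s ks

widthFormula : List ℕ → ℕ
widthFormula [] = 0
widthFormula (k ∷ ks) = k C ⌈ k /2⌉ + tailSum (+ ⌈ k /2⌉) ks

binSum : List ℕ → ℕ
binSum ks = sum (map (2 ^_) ks)

-- Read a subset of [n] as the binary number whose bit i records whether i + 1 is an element;
-- its rank in the binary order is that number, so 𝒞(d) consists of the sets of value below d.
--
-- Upper bound: sending a set to the bottom of its Greene–Kleitman symmetric chain does not raise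
-- its value, lands on a ballot sequence, and is injective on antichains, since two sets with the
-- same bottom lie on one chain.  So an antichain in 𝒞(d) is no larger than the number of
-- ballot sequences of value below d.  Splitting on the leading bit 2^k of d, those below 2^k
-- are counted by the ballot theorem and the rest recursively, with the walk now required to
-- end higher; this gives at most ∑ C(k_i, s_i).
--
-- Lower bound: for d = 2^k + d′, the layer of s-subsets of [k] together with an antichain
-- built in the same way for d′ from sets of size below s, each extended by k + 1.

module Submission where

open import Defs
open import Data.Bool using (Bool; true; false)
open import Data.Bool.Properties using () renaming (_≟_ to _≟ᴮ_)
open import Data.Nat using (ℕ; zero; suc; _+_; _*_; _∸_; _<_; _≤_; _>_; _^_; z≤n; s≤s; ⌊_/2⌋; ⌈_/2⌉)
open import Data.Nat.Combinatorics using (_C_; nCk≡nC[n∸k]; nCk+nC[k+1]≡[n+1]C[k+1])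
open import Data.Nat.Properties
open import Data.Nat.Tactic.RingSolver using (solve-∀)
open import Data.Integer as ℤ using (ℤ)
import Data.Integer.Properties as ℤ
open import Data.Fin using (zero; suc)
open import Data.Fin.Subset using (Subset; _⊆_; ∣_∣)
open import Data.Fin.Subset.Properties using (drop-∷-⊆; ⊆-refl; ⊆-reflexive; out⊆; s⊆s; p⊆q⇒∣p∣≤∣q∣)
open import Data.Vec using (Vec; []; _∷_; _∷ʳ_; lookup; initLast; here; there)
open import Data.Vec.Properties using (≡-dec; ∷-injectiveˡ; ∷-injectiveʳ; tabulate∘lookup; tabulate-cong)
open import Data.List using (List; []; _∷_; _++_; map; filter; length)
open import Data.List.Properties using (length-++; length-map; filter-++; filter-≐; filter-none; filter-notAll)
open import Data.List.Membership.Propositional using (_∈_)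
open import Data.List.Membership.Propositional.Properties using (∈-map⁺; ∈-map⁻; ∈-++⁺ˡ; ∈-++⁺ʳ; ∈-filter⁺)
import Data.List.Relation.Unary.Any as Any
open import Data.List.Relation.Unary.All using (All; []; _∷_)
import Data.List.Relation.Unary.All as All
import Data.List.Relation.Unary.All.Properties as All
open import Data.List.Relation.Unary.AllPairs using (AllPairs; []; _∷_)
import Data.List.Relation.Unary.AllPairs as AllPairs
import Data.List.Relation.Unary.AllPairs.Properties as AllPairs
open import Data.List.Relation.Unary.Unique.Propositional using (Unique)
open import Data.List.Relation.Unary.Linked using (Linked; [-]; _∷_)
open import Data.Product using (∃; _×_; _,_)
import Data.Product as Product
open import Data.Sum using (_⊎_; inj₁; inj₂)
import Data.Sum as Sum
open import Function using (_∘_)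
open import Data.Empty using (⊥-elim)
open import Relation.Nullary using (¬_; ¬?; Dec; yes; no)
open import Relation.Nullary.Decidable using (_×-dec_)
open import Level using (0ℓ)
open import Relation.Unary using (Pred; Decidable; _≐_)
open import Relation.Unary.Properties using (_∪?_)
open import Relation.Binary.PropositionalEquality
open import Relation.Binary.Definitions using (DecidableEquality; tri<; tri≈; tri>)

private
  variable
    n : ℕ

module _ {A : Set} where

  count : {P : Pred A 0ℓ} → Decidable P → List A → ℕ
  count P? xs = length (filter P? xs)

  module _ {P Q : Pred A 0ℓ} (P? : Decidable P) (Q? : Decidable Q) where

    count-≐ : P ≐ Q → ∀ xs → count P? xs ≡ count Q? xs
    count-≐ P≐Q xs = cong length (filter-≐ P? Q? P≐Q xs)

    count-∪ : (∀ {x} → P x → ¬ Q x) → ∀ xs → count (P? ∪? Q?) xs ≡ count P? xs + count Q? xs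
    count-∪ disjoint [] = refl
    count-∪ disjoint (x ∷ xs) with P? x | Q? x
    ... | yes p | yes q = ⊥-elim (disjoint p q)
    ... | yes _ | no _  = cong suc (count-∪ disjoint xs)
    ... | no _  | yes _ = trans (cong suc (count-∪ disjoint xs)) (sym (+-suc _ _))
    ... | no _  | no _  = count-∪ disjoint xs

  module _ {P : Pred A 0ℓ} (P? : Decidable P) where

    count-++ : ∀ xs ys → count P? (xs ++ ys) ≡ count P? xs + count P? ys
    count-++ xs ys = trans (cong length (filter-++ P? xs ys)) (length-++ (filter P? xs))

    count-none : (∀ x → ¬ P x) → ∀ xs → count P? xs ≡ 0
    count-none ¬P xs = cong length (filter-none P? (All.universal ¬P xs))

count-map : {A B : Set} {P : Pred B 0ℓ} (P? : Decidable P) (f : A → B) (xs : List A) →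
            count P? (map f xs) ≡ count (λ x → P? (f x)) xs
count-map P? f [] = refl
count-map P? f (x ∷ xs) with P? (f x)
... | yes _ = cong suc (count-map P? f xs)
... | no _  = count-map P? f xs

length-map-++-map : {A B : Set} (f g : A → B) (xs ys : List A) →
                    length (map f xs ++ map g ys) ≡ length xs + length ys
length-map-++-map f g xs ys =
  trans (length-++ (map f xs)) (cong₂ _+_ (length-map f xs) (length-map g ys))

lookup-injective : {A : Set} (xs ys : Vec A n) → (∀ i → lookup xs i ≡ lookup ys i) → xs ≡ ys
lookup-injective xs ys eq =
  trans (sym (tabulate∘lookup xs)) (trans (tabulate-cong eq) (tabulate∘lookup ys))

module _ {A : Set} (_≟_ : DecidableEquality A) where

  private
    remove : A → List A → List A
    remove x = filter (λ y → ¬? (y ≟ x))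

  Unique-⊆⇒length≤ : {xs ys : List A} → Unique xs → (∀ {x} → x ∈ xs → x ∈ ys) → length xs ≤ length ys
  Unique-⊆⇒length≤ {[]} _ _ = z≤n
  Unique-⊆⇒length≤ {x ∷ xs} {ys} (x∉xs ∷ unique) xs⊆ys = begin-strict
    length xs             ≤⟨ Unique-⊆⇒length≤ unique xs⊆ys∖x ⟩
    length (remove x ys)  <⟨ filter-notAll _ ys (Any.map (λ x≡y y≢x → y≢x (sym x≡y)) x∈ys) ⟩
    length ys             ∎
    where
    open ≤-Reasoning
    x∈ys : x ∈ ys
    x∈ys = xs⊆ys (Any.here refl)
    xs⊆ys∖x : ∀ {y} → y ∈ xs → y ∈ remove x ys
    xs⊆ys∖x y∈xs = ∈-filter⁺ _ (xs⊆ys (Any.there y∈xs)) (λ y≡x → All.lookup x∉xs y∈xs (sym y≡x))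

∸≡2+∸[2+] : ∀ n t → 2 + t ≤ n → n ∸ t ≡ 2 + (n ∸ (2 + t))
∸≡2+∸[2+] (suc (suc n)) zero _ = refl
∸≡2+∸[2+] (suc n) (suc t) (s≤s 2+t≤n) = ∸≡2+∸[2+] n t 2+t≤n

nC⌊n/2⌋≡nC⌈n/2⌉ : ∀ n → n C ⌊ n /2⌋ ≡ n C ⌈ n /2⌉
nC⌊n/2⌋≡nC⌈n/2⌉ n = trans (nCk≡nC[n∸k] (⌊n/2⌋≤n n))
  (cong (n C_) (trans (cong (_∸ ⌊ n /2⌋) (sym (⌊n/2⌋+⌈n/2⌉≡n n))) (m+n∸m≡n ⌊ n /2⌋ ⌈ n /2⌉)))

pascal : ∀ n k → n C suc k + n C k ≡ suc n C suc k
pascal n k = trans (+-comm (n C suc k) (n C k)) (nCk+nC[k+1]≡[n+1]C[k+1] n k)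

i≤j-1⇒i<j : ∀ {i j} → i ℤ.≤ j ℤ.- ℤ.+ 1 → i ℤ.< j
i≤j-1⇒i<j {j = j} = ℤ.i≤pred[j]⇒i<j ∘ subst (_ ℤ.≤_) (ℤ.+-comm j ℤ.-1ℤ)

_≟ˢ_ : (A B : Subset n) → Dec (A ≡ B)
_≟ˢ_ = ≡-dec _≟ᴮ_

count-allSubsets : ∀ n {P : Pred (Subset (suc n)) 0ℓ} (P? : Decidable P) →
  count P? (allSubsets (suc n)) ≡
  count (λ B → P? (false ∷ B)) (allSubsets n) + count (λ B → P? (true ∷ B)) (allSubsets n)
count-allSubsets n P? = trans (count-++ P? (map (false ∷_) S) (map (true ∷_) S))
  (cong₂ _+_ (count-map P? (false ∷_) S) (count-map P? (true ∷_) S))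
  where S = allSubsets n

module _ {A : Subset n} (xs : List (Subset n)) where

  count-∷≟∷ : ∀ x → count (λ B → (x ∷ B) ≟ˢ (x ∷ A)) xs ≡ count (_≟ˢ A) xs
  count-∷≟∷ x = count-≐ _ (_≟ˢ A) (∷-injectiveʳ , cong (x ∷_)) xs

  count-∷≟∷-≢ : ∀ {x y} → x ≢ y → count (λ B → (x ∷ B) ≟ˢ (y ∷ A)) xs ≡ 0
  count-∷≟∷-≢ x≢y = count-none _ (λ B e → x≢y (∷-injectiveˡ e)) xs

count-≡-allSubsets : ∀ n (A : Subset n) → count (_≟ˢ A) (allSubsets n) ≡ 1
count-≡-allSubsets zero [] = refl
count-≡-allSubsets (suc n) (false ∷ A) = trans (count-allSubsets n (_≟ˢ (false ∷ A)))
  (cong₂ _+_ (trans (count-∷≟∷ (allSubsets n) false) (count-≡-allSubsets n A))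
             (count-∷≟∷-≢ (allSubsets n) (λ ())))
count-≡-allSubsets (suc n) (true ∷ A) = trans (count-allSubsets n (_≟ˢ (true ∷ A)))
  (cong₂ _+_ (count-∷≟∷-≢ (allSubsets n) (λ ()))
             (trans (count-∷≟∷ (allSubsets n) true) (count-≡-allSubsets n A)))

bit : Bool → ℕ
bit false = 0
bit true = 1

value : Subset n → ℕ
value [] = 0
value (b ∷ B) = bit b + 2 * value B

<b-irrefl : (A : Subset n) → ¬ (A <b A)
<b-irrefl A (i , A[i]≡false , A[i]≡true , _) with trans (sym A[i]≡false) A[i]≡true
... | ()

module _ {x a : Bool} {B A : Subset n} where

  ∷-<b-∷⁻ : (x ∷ B) <b (a ∷ A) → (B <b A) ⊎ (B ≡ A × x ≡ false × a ≡ true)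
  ∷-<b-∷⁻ (zero , x≡false , a≡true , above) =
    inj₂ (lookup-injective B A (λ j → above (suc j) (s≤s z≤n)) , x≡false , a≡true)
  ∷-<b-∷⁻ (suc i , B[i]≡false , A[i]≡true , above) =
    inj₁ (i , B[i]≡false , A[i]≡true , λ j i<j → above (suc j) (s≤s i<j))

  ∷-<b-∷⁺ : (B <b A) ⊎ (B ≡ A × x ≡ false × a ≡ true) → (x ∷ B) <b (a ∷ A)
  ∷-<b-∷⁺ (inj₁ (i , B[i]≡false , A[i]≡true , above)) =
    suc i , B[i]≡false , A[i]≡true , λ { zero () ; (suc j) (s≤s i<j) → above j i<j }
  ∷-<b-∷⁺ (inj₂ (refl , x≡false , a≡true)) =
    zero , x≡false , a≡true , λ { zero () ; (suc j) _ → refl }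

Tie : Subset n → Bool → Bool → Pred (Subset n) 0ℓ
Tie A x a B = B ≡ A × x ≡ false × a ≡ true

tie? : (A : Subset n) (x a : Bool) → Decidable (Tie A x a)
tie? A x a B = (B ≟ˢ A) ×-dec (x ≟ᴮ false) ×-dec (a ≟ᴮ true)

count-ties : ∀ a (A : Subset n) →
  count (tie? A false a) (allSubsets n) + count (tie? A true a) (allSubsets n) ≡ bit a
count-ties {n} false A =
  cong₂ _+_ (count-none _ (λ { _ (_ , _ , ()) }) (allSubsets n))
            (count-none _ (λ { _ (_ , () , _) }) (allSubsets n))
count-ties {n} true A =
  cong₂ _+_ (trans (count-≐ _ (_≟ˢ A) ((λ (B≡A , _) → B≡A) , λ B≡A → B≡A , refl , refl) S)
                   (count-≡-allSubsets n A))
            (count-none _ (λ { _ (_ , () , _) }) S)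
  where S = allSubsets n

rank-∷ : ∀ a (A : Subset n) → rank (a ∷ A) ≡ bit a + 2 * rank A
rank-∷ {n} a A = begin
  rank (a ∷ A)                                     ≡⟨ count-allSubsets n (_<b? (a ∷ A)) ⟩
  below false + below true                         ≡⟨ cong₂ _+_ (below≡ false) (below≡ true) ⟩
  (rank A + ties false) + (rank A + ties true)     ≡⟨ regroup (rank A) (ties false) (ties true) ⟩
  (ties false + ties true) + 2 * rank A            ≡⟨ cong (_+ 2 * rank A) (count-ties a A) ⟩
  bit a + 2 * rank A                               ∎
  where
  open ≡-Reasoning
  below ties : Bool → ℕ
  S = allSubsets n
  below x = count (λ B → (x ∷ B) <b? (a ∷ A)) S
  ties x = count (tie? A x a) S
  below≡ : ∀ x → below x ≡ rank A + ties x
  below≡ x = trans (count-≐ _ ((_<b? A) ∪? tie? A x a) (∷-<b-∷⁻ , ∷-<b-∷⁺) S)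
                   (count-∪ (_<b? A) (tie? A x a) (λ { {B} B<A (refl , _) → <b-irrefl B B<A }) S)
  regroup : ∀ r t₀ t₁ → (r + t₀) + (r + t₁) ≡ (t₀ + t₁) + 2 * r
  regroup = solve-∀

rank≡value : (A : Subset n) → rank A ≡ value A
rank≡value [] = refl
rank≡value (a ∷ A) = trans (rank-∷ a A) (cong (λ r → bit a + 2 * r) (rank≡value A))

inside∷⊈outside∷ : {X Y : Subset n} → ¬ (true ∷ X ⊆ false ∷ Y)
inside∷⊈outside∷ X⊆Y with X⊆Y here
... | ()

⊆⇒value≤ : {X Y : Subset n} → X ⊆ Y → value X ≤ value Y
⊆⇒value≤ {X = []} {[]} _ = z≤n
⊆⇒value≤ {X = false ∷ X} {false ∷ Y} X⊆Y = *-monoʳ-≤ 2 (⊆⇒value≤ (drop-∷-⊆ X⊆Y))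
⊆⇒value≤ {X = false ∷ X} {true ∷ Y} X⊆Y = m≤n⇒m≤1+n (*-monoʳ-≤ 2 (⊆⇒value≤ (drop-∷-⊆ X⊆Y)))
⊆⇒value≤ {X = true ∷ X} {true ∷ Y} X⊆Y = s≤s (*-monoʳ-≤ 2 (⊆⇒value≤ (drop-∷-⊆ X⊆Y)))
⊆⇒value≤ {X = true ∷ X} {false ∷ Y} X⊆Y = ⊥-elim (inside∷⊈outside∷ X⊆Y)

value<2^n : (X : Subset n) → value X < 2 ^ n
value<2^n [] = s≤s z≤n
value<2^n {suc n} (b ∷ X) = begin-strict
  bit b + 2 * value X   <⟨ +-monoˡ-< (2 * value X) (bit<2 b) ⟩
  2 + 2 * value X       ≡⟨ sym (*-suc 2 (value X)) ⟩
  2 * suc (value X)     ≤⟨ *-monoʳ-≤ 2 (value<2^n X) ⟩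
  2 * 2 ^ n             ∎
  where
  open ≤-Reasoning
  bit<2 : ∀ b → bit b < 2
  bit<2 false = s≤s z≤n
  bit<2 true = s≤s (s≤s z≤n)

value-∷ʳ : (X : Subset n) (b : Bool) → value (X ∷ʳ b) ≡ value X + bit b * 2 ^ n
value-∷ʳ [] false = refl
value-∷ʳ [] true = refl
value-∷ʳ {suc n} (x ∷ X) b = begin
  bit x + 2 * value (X ∷ʳ b)               ≡⟨ cong (λ v → bit x + 2 * v) (value-∷ʳ X b) ⟩
  bit x + 2 * (value X + bit b * 2 ^ n)    ≡⟨ regroup (bit x) (value X) (bit b) (2 ^ n) ⟩
  (bit x + 2 * value X) + bit b * 2 ^ suc n ∎
  where
  open ≡-Reasoning
  regroup : ∀ a v p q → a + 2 * (v + p * q) ≡ (a + 2 * v) + p * (2 * q)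
  regroup = solve-∀

value-∷ʳfalse : (X : Subset n) → value (X ∷ʳ false) ≡ value X
value-∷ʳfalse X = trans (value-∷ʳ X false) (+-identityʳ (value X))

value-∷ʳtrue : (X : Subset n) → value (X ∷ʳ true) ≡ value X + 2 ^ n
value-∷ʳtrue {n} X = trans (value-∷ʳ X true) (cong (value X +_) (+-identityʳ (2 ^ n)))

∷ʳ-⊆⁻ : {X Y : Subset n} {a b : Bool} → X ∷ʳ a ⊆ Y ∷ʳ b → X ⊆ Y
∷ʳ-⊆⁻ {X = x ∷ X} {y ∷ Y} X⊆Y here with X⊆Y here
... | here = here
∷ʳ-⊆⁻ {X = x ∷ X} {y ∷ Y} X⊆Y (there p) = there (∷ʳ-⊆⁻ (drop-∷-⊆ X⊆Y) p)

∷ʳinside⊈∷ʳoutside : {X Y : Subset n} → ¬ (X ∷ʳ true ⊆ Y ∷ʳ false)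
∷ʳinside⊈∷ʳoutside {X = []} {[]} X⊆Y = inside∷⊈outside∷ X⊆Y
∷ʳinside⊈∷ʳoutside {X = x ∷ X} {y ∷ Y} X⊆Y = ∷ʳinside⊈∷ʳoutside (drop-∷-⊆ X⊆Y)

∣p∷ʳfalse∣≡∣p∣ : (X : Subset n) → ∣ X ∷ʳ false ∣ ≡ ∣ X ∣
∣p∷ʳfalse∣≡∣p∣ [] = refl
∣p∷ʳfalse∣≡∣p∣ (false ∷ X) = ∣p∷ʳfalse∣≡∣p∣ X
∣p∷ʳfalse∣≡∣p∣ (true ∷ X) = cong suc (∣p∷ʳfalse∣≡∣p∣ X)

∣p∷ʳtrue∣≡1+∣p∣ : (X : Subset n) → ∣ X ∷ʳ true ∣ ≡ suc ∣ X ∣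
∣p∷ʳtrue∣≡1+∣p∣ [] = refl
∣p∷ʳtrue∣≡1+∣p∣ (false ∷ X) = ∣p∷ʳtrue∣≡1+∣p∣ X
∣p∷ʳtrue∣≡1+∣p∣ (true ∷ X) = cong suc (∣p∷ʳtrue∣≡1+∣p∣ X)

Incomparable : Subset n → Subset n → Set
Incomparable A B = ¬ A ⊆ B × ¬ B ⊆ A

antichain-map-∷ : ∀ b {L : List (Subset n)} → AllPairs Incomparable L →
                  AllPairs Incomparable (map (b ∷_) L)
antichain-map-∷ b antichain =
  AllPairs.map⁺ (AllPairs.map (λ (A⊈B , B⊈A) → A⊈B ∘ drop-∷-⊆ , B⊈A ∘ drop-∷-⊆) antichain)

antichain-map-∷ʳ : ∀ b {L : List (Subset n)} → AllPairs Incomparable L →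
                   AllPairs Incomparable (map (_∷ʳ b) L)
antichain-map-∷ʳ b antichain =
  AllPairs.map⁺ (AllPairs.map (λ (A⊈B , B⊈A) → A⊈B ∘ ∷ʳ-⊆⁻ , B⊈A ∘ ∷ʳ-⊆⁻) antichain)

IsAntichainInC⇒ : ∀ {d} {L : List (Subset n)} → IsAntichainInC d L →
                  AllPairs Incomparable L × All (λ A → value A < d) L
IsAntichainInC⇒ {d = d} (_ , inC , antichain) =
  antichain , All.map (λ {A} rank<d → subst (_< d) (rank≡value A) rank<d) inC

⇒IsAntichainInC : ∀ {d} {L : List (Subset n)} → AllPairs Incomparable L →
                  All (λ A → value A < d) L → IsAntichainInC d L
⇒IsAntichainInC {d = d} antichain values =
  AllPairs.map (λ (A⊈B , _) A≡B → A⊈B (⊆-reflexive A≡B)) antichain ,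
  All.map (λ {A} value<d → subst (_< d) (sym (rank≡value A)) value<d) values ,
  antichain

-- Read from the least significant bit, c counts the zeros not yet matched by a later one; a one
-- matching an open zero is kept and an unmatched one is cleared.  So bottom 0 X is the least
-- element of the Greene–Kleitman symmetric chain through X.
bottom : ℕ → Subset n → Subset n
bottom c [] = []
bottom c (false ∷ X) = false ∷ bottom (suc c) X
bottom zero (true ∷ X) = false ∷ bottom zero X
bottom (suc c) (true ∷ X) = true ∷ bottom c X

bottom-⊆ : ∀ c (X : Subset n) → bottom c X ⊆ X
bottom-⊆ c [] = ⊆-refl
bottom-⊆ c (false ∷ X) = out⊆ (bottom-⊆ (suc c) X)
bottom-⊆ zero (true ∷ X) = out⊆ (bottom-⊆ zero X)
bottom-⊆ (suc c) (true ∷ X) = s⊆s (bottom-⊆ c X)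

bottom-<-≡⇒⊇ : ∀ c c′ (X Y : Subset n) → c < c′ → bottom c X ≡ bottom c′ Y → Y ⊆ X
bottom-<-≡⇒⊇ c c′ [] [] c<c′ eq = ⊆-refl
bottom-<-≡⇒⊇ c c′ (false ∷ X) (false ∷ Y) c<c′ eq =
  s⊆s (bottom-<-≡⇒⊇ (suc c) (suc c′) X Y (s≤s c<c′) (∷-injectiveʳ eq))
bottom-<-≡⇒⊇ c (suc c′) (false ∷ X) (true ∷ Y) c<c′ eq with () ← ∷-injectiveˡ eq
bottom-<-≡⇒⊇ zero c′ (true ∷ X) (false ∷ Y) c<c′ eq =
  out⊆ (bottom-<-≡⇒⊇ zero (suc c′) X Y (s≤s z≤n) (∷-injectiveʳ eq))
bottom-<-≡⇒⊇ (suc c) c′ (true ∷ X) (false ∷ Y) c<c′ eq with () ← ∷-injectiveˡ eq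
bottom-<-≡⇒⊇ zero (suc c′) (true ∷ X) (true ∷ Y) c<c′ eq with () ← ∷-injectiveˡ eq
bottom-<-≡⇒⊇ (suc c) (suc c′) (true ∷ X) (true ∷ Y) (s≤s c<c′) eq =
  s⊆s (bottom-<-≡⇒⊇ c c′ X Y c<c′ (∷-injectiveʳ eq))

bottom-≡⇒comparable : ∀ c (X Y : Subset n) → bottom c X ≡ bottom c Y → X ⊆ Y ⊎ Y ⊆ X
bottom-≡⇒comparable c [] [] eq = inj₁ ⊆-refl
bottom-≡⇒comparable c (false ∷ X) (false ∷ Y) eq =
  Sum.map s⊆s s⊆s (bottom-≡⇒comparable (suc c) X Y (∷-injectiveʳ eq))
bottom-≡⇒comparable zero (true ∷ X) (true ∷ Y) eq =
  Sum.map s⊆s s⊆s (bottom-≡⇒comparable zero X Y (∷-injectiveʳ eq))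
bottom-≡⇒comparable (suc c) (true ∷ X) (true ∷ Y) eq =
  Sum.map s⊆s s⊆s (bottom-≡⇒comparable c X Y (∷-injectiveʳ eq))
bottom-≡⇒comparable zero (true ∷ X) (false ∷ Y) eq =
  inj₂ (out⊆ (bottom-<-≡⇒⊇ zero 1 X Y (s≤s z≤n) (∷-injectiveʳ eq)))
bottom-≡⇒comparable zero (false ∷ X) (true ∷ Y) eq =
  inj₁ (out⊆ (bottom-<-≡⇒⊇ zero 1 Y X (s≤s z≤n) (sym (∷-injectiveʳ eq))))
bottom-≡⇒comparable (suc c) (true ∷ X) (false ∷ Y) eq with () ← ∷-injectiveˡ eq
bottom-≡⇒comparable (suc c) (false ∷ X) (true ∷ Y) eq with () ← ∷-injectiveˡ eq

data Ballot : ℕ → ℕ → Subset n → Set where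
  []   : ∀ {c} → Ballot c c []
  up   : ∀ {c e} {X : Subset n} → Ballot (suc c) e X → Ballot c e (false ∷ X)
  down : ∀ {c e} {X : Subset n} → Ballot c e X → Ballot (suc c) e (true ∷ X)

Ballot-raise : ∀ {c e} {X : Subset n} → Ballot c e X → Ballot (suc c) (suc e) X
Ballot-raise [] = []
Ballot-raise (up b) = up (Ballot-raise b)
Ballot-raise (down b) = down (Ballot-raise b)

bottom-Ballot : ∀ c (X : Subset n) → ∃ λ e → Ballot c e (bottom c X)
bottom-Ballot c [] = c , []
bottom-Ballot c (false ∷ X) = Product.map₂ up (bottom-Ballot (suc c) X)
bottom-Ballot zero (true ∷ X) = Product.map suc (up ∘ Ballot-raise) (bottom-Ballot zero X)
bottom-Ballot (suc c) (true ∷ X) = Product.map₂ down (bottom-Ballot c X)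

Ballot-∷ʳfalse⁻ : ∀ {c e} (X : Subset n) → Ballot c e (X ∷ʳ false) →
                  ∃ λ e′ → Ballot c e′ X × e ≡ suc e′
Ballot-∷ʳfalse⁻ [] (up []) = _ , [] , refl
Ballot-∷ʳfalse⁻ (false ∷ X) (up b) = Product.map₂ (Product.map₁ up) (Ballot-∷ʳfalse⁻ X b)
Ballot-∷ʳfalse⁻ (true ∷ X) (down b) = Product.map₂ (Product.map₁ down) (Ballot-∷ʳfalse⁻ X b)

Ballot-∷ʳtrue⁻ : ∀ {c e} (X : Subset n) → Ballot c e (X ∷ʳ true) → Ballot c (suc e) X
Ballot-∷ʳtrue⁻ [] (down []) = []
Ballot-∷ʳtrue⁻ (false ∷ X) (up b) = up (Ballot-∷ʳtrue⁻ X b)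
Ballot-∷ʳtrue⁻ (true ∷ X) (down b) = down (Ballot-∷ʳtrue⁻ X b)

-- The X with value X < d and Ballot 0 e X for some e ≥ t.
ballots : (n d t : ℕ) → List (Subset n)
ballots zero zero t = []
ballots zero (suc d) zero = [] ∷ []
ballots zero (suc d) (suc t) = []
ballots (suc n) d t =
  map (_∷ʳ false) (ballots n d (t ∸ 1)) ++ map (_∷ʳ true) (ballots n (d ∸ 2 ^ n) (suc t))

#ballots : (n d t : ℕ) → ℕ
#ballots zero zero t = 0
#ballots zero (suc d) zero = 1
#ballots zero (suc d) (suc t) = 0
#ballots (suc n) d t = #ballots n d (t ∸ 1) + #ballots n (d ∸ 2 ^ n) (suc t)

length-ballots : ∀ n d t → length (ballots n d t) ≡ #ballots n d t
length-ballots zero zero t = refl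
length-ballots zero (suc d) zero = refl
length-ballots zero (suc d) (suc t) = refl
length-ballots (suc n) d t = trans
  (length-map-++-map (_∷ʳ false) (_∷ʳ true) (ballots n d (t ∸ 1)) (ballots n (d ∸ 2 ^ n) (suc t)))
  (cong₂ _+_ (length-ballots n d (t ∸ 1)) (length-ballots n (d ∸ 2 ^ n) (suc t)))

∈-ballots : ∀ n d t {e} (X : Subset n) → Ballot 0 e X → t ≤ e → value X < d → X ∈ ballots n d t
∈-ballots zero (suc d) zero [] [] t≤e X<d = Any.here refl
∈-ballots (suc n) d t X b t≤e X<d with initLast X
... | Y , false , refl with Ballot-∷ʳfalse⁻ Y b
...   | e′ , b′ , refl = ∈-++⁺ˡ (∈-map⁺ (_∷ʳ false)
          (∈-ballots n d (t ∸ 1) Y b′ (∸-monoˡ-≤ 1 t≤e) (subst (_< d) (value-∷ʳfalse Y) X<d)))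
∈-ballots (suc n) d t X b t≤e X<d | Y , true , refl =
  ∈-++⁺ʳ (map (_∷ʳ false) (ballots n d (t ∸ 1))) (∈-map⁺ (_∷ʳ true)
    (∈-ballots n (d ∸ 2 ^ n) (suc t) Y (Ballot-∷ʳtrue⁻ Y b) (s≤s t≤e)
      (m+n≤o⇒m≤o∸n (suc (value Y)) (subst (λ v → suc v ≤ d) (value-∷ʳtrue Y) X<d))))

antichain≤#ballots : ∀ d (L : List (Subset n)) → AllPairs Incomparable L →
                     All (λ A → value A < d) L → length L ≤ #ballots n d 0
antichain≤#ballots {n} d L antichain values = begin
  length L                      ≡⟨ length-map (bottom 0) L ⟨
  length (map (bottom 0) L)     ≤⟨ Unique-⊆⇒length≤ _≟ˢ_ bottoms-unique bottoms-ballots ⟩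
  length (ballots n d 0)        ≡⟨ length-ballots n d 0 ⟩
  #ballots n d 0                ∎
  where
  open ≤-Reasoning
  bottoms-unique : Unique (map (bottom 0) L)
  bottoms-unique = AllPairs.map⁺ (AllPairs.map distinct antichain)
    where
    distinct : ∀ {A B} → Incomparable A B → bottom 0 A ≢ bottom 0 B
    distinct {A} {B} (A⊈B , B⊈A) eq = Sum.[ A⊈B , B⊈A ] (bottom-≡⇒comparable 0 A B eq)
  bottoms-ballots : ∀ {X} → X ∈ map (bottom 0) L → X ∈ ballots n d 0
  bottoms-ballots X∈ with ∈-map⁻ (bottom 0) X∈
  ... | A , A∈L , refl with bottom-Ballot 0 A
  ...   | e , b = ∈-ballots n d 0 (bottom 0 A) b z≤n
                    (≤-<-trans (⊆⇒value≤ (bottom-⊆ 0 A)) (All.lookup values A∈L))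

#ballots-empty : ∀ n t → #ballots n 0 t ≡ 0
#ballots-empty zero t = refl
#ballots-empty (suc n) t = cong₂ _+_ (#ballots-empty n (t ∸ 1))
  (trans (cong (λ d → #ballots n d (suc t)) (0∸n≡0 (2 ^ n))) (#ballots-empty n (suc t)))

#ballots-unreachable : ∀ n d t → n < t → #ballots n d t ≡ 0
#ballots-unreachable zero zero t _ = refl
#ballots-unreachable zero (suc d) (suc t) _ = refl
#ballots-unreachable (suc n) d (suc t) (s≤s n<t) = cong₂ _+_
  (#ballots-unreachable n d t n<t)
  (#ballots-unreachable n (d ∸ 2 ^ n) (2 + t) (m<n⇒m<1+n (m<n⇒m<1+n n<t)))

#ballots-saturated : ∀ n {d} t → 2 ^ n ≤ d → #ballots n d t ≡ #ballots n (2 ^ n) t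
#ballots-saturated-split : ∀ n {d} t → 2 ^ suc n ≤ d →
  #ballots (suc n) d t ≡ #ballots n (2 ^ n) (t ∸ 1) + #ballots n (2 ^ n) (suc t)

#ballots-saturated zero {suc d} zero _ = refl
#ballots-saturated zero {suc d} (suc t) _ = refl
#ballots-saturated (suc n) t 2^n≤d =
  trans (#ballots-saturated-split n t 2^n≤d) (sym (#ballots-saturated-split n t ≤-refl))

#ballots-saturated-split n {d} t 2^[1+n]≤d = cong₂ _+_
  (#ballots-saturated n (t ∸ 1) (≤-trans (m≤m+n (2 ^ n) _) 2^[1+n]≤d))
  (#ballots-saturated n (suc t)
    (m+n≤o⇒m≤o∸n (2 ^ n) (subst (_≤ d) (cong (2 ^ n +_) (+-identityʳ (2 ^ n))) 2^[1+n]≤d)))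

#ballots-all : ∀ n t → t ≤ n → #ballots n (2 ^ n) t ≡ n C ⌊ (n ∸ t) /2⌋
#ballots-all zero zero _ = refl
#ballots-all (suc zero) zero _ = refl
#ballots-all (suc (suc m)) zero _ = begin
  #ballots (suc (suc m)) (2 ^ suc (suc m)) 0       ≡⟨ #ballots-saturated-split (suc m) 0 ≤-refl ⟩
  #ballots (suc m) (2 ^ suc m) 0 + #ballots (suc m) (2 ^ suc m) 1
    ≡⟨ cong₂ _+_ (#ballots-all (suc m) 0 z≤n) (#ballots-all (suc m) 1 (s≤s z≤n)) ⟩
  suc m C ⌊ suc m /2⌋ + suc m C ⌊ m /2⌋
    ≡⟨ cong (_+ suc m C ⌊ m /2⌋) (nC⌊n/2⌋≡nC⌈n/2⌉ (suc m)) ⟩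
  suc m C suc ⌊ m /2⌋ + suc m C ⌊ m /2⌋          ≡⟨ pascal (suc m) ⌊ m /2⌋ ⟩
  suc (suc m) C suc ⌊ m /2⌋                       ∎
  where open ≡-Reasoning
#ballots-all (suc n) (suc t) (s≤s t≤n) =
  trans (#ballots-saturated-split n (suc t) ≤-refl) (combine (2 + t ≤? n))
  where
  open ≡-Reasoning
  combine : Dec (2 + t ≤ n) →
            #ballots n (2 ^ n) t + #ballots n (2 ^ n) (2 + t) ≡ suc n C ⌊ (n ∸ t) /2⌋
  combine (yes 2+t≤n) = begin
    #ballots n (2 ^ n) t + #ballots n (2 ^ n) (2 + t)
      ≡⟨ cong₂ _+_ (#ballots-all n t t≤n) (#ballots-all n (2 + t) 2+t≤n) ⟩
    n C ⌊ (n ∸ t) /2⌋ + n C j        ≡⟨ cong (λ m → n C ⌊ m /2⌋ + n C j) (∸≡2+∸[2+] n t 2+t≤n) ⟩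
    n C suc j + n C j                ≡⟨ pascal n j ⟩
    suc n C suc j                    ≡⟨ cong (λ m → suc n C ⌊ m /2⌋) (∸≡2+∸[2+] n t 2+t≤n) ⟨
    suc n C ⌊ (n ∸ t) /2⌋            ∎
    where j = ⌊ (n ∸ (2 + t)) /2⌋
  combine (no 2+t≰n) = begin
    #ballots n (2 ^ n) t + #ballots n (2 ^ n) (2 + t)
      ≡⟨ cong₂ _+_ (#ballots-all n t t≤n) (#ballots-unreachable n (2 ^ n) (2 + t) (≰⇒> 2+t≰n)) ⟩
    n C ⌊ (n ∸ t) /2⌋ + 0            ≡⟨ +-identityʳ _ ⟩
    n C ⌊ (n ∸ t) /2⌋                ≡⟨ cong (n C_) ⌊n∸t/2⌋≡0 ⟩
    1                                ≡⟨ cong (suc n C_) ⌊n∸t/2⌋≡0 ⟨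
    suc n C ⌊ (n ∸ t) /2⌋            ∎
    where
    n∸t≤1 : n ∸ t ≤ 1
    n∸t≤1 = subst (n ∸ t ≤_) (m+n∸n≡m 1 t) (∸-monoˡ-≤ t (≤-pred (≰⇒> 2+t≰n)))
    ⌊n∸t/2⌋≡0 : ⌊ (n ∸ t) /2⌋ ≡ 0
    ⌊n∸t/2⌋≡0 with n ∸ t | n∸t≤1
    ... | zero | _ = refl
    ... | suc zero | _ = refl
    ... | suc (suc _) | s≤s ()

#ballots-below-top : ∀ n {d} t → d ≤ 2 ^ n → #ballots (suc n) d t ≡ #ballots n d (t ∸ 1)
#ballots-below-top n {d} t d≤2^n = trans
  (cong (#ballots n d (t ∸ 1) +_)
        (trans (cong (λ d′ → #ballots n d′ (suc t)) (m≤n⇒m∸n≡0 d≤2^n)) (#ballots-empty n (suc t))))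
  (+-identityʳ _)

#ballots-with-top : ∀ n d t →
  #ballots (suc n) (2 ^ n + d) t ≡ #ballots n (2 ^ n) (t ∸ 1) + #ballots n d (suc t)
#ballots-with-top n d t = cong₂ _+_
  (#ballots-saturated n (t ∸ 1) (m≤m+n (2 ^ n) d))
  (cong (λ d′ → #ballots n d′ (suc t)) (m+n∸m≡n (2 ^ n) d))

binSum<2^[1+k] : ∀ {k ks} → Linked _>_ (k ∷ ks) → binSum (k ∷ ks) < 2 ^ suc k
binSum<2^[1+k] {k} {ks} decreasing = +-monoʳ-< (2 ^ k) (tail< decreasing)
  where
  tail< : Linked _>_ (k ∷ ks) → binSum ks < 2 ^ k + 0
  tail< [-] = ≤-trans (m^n>0 2 k) (m≤m+n (2 ^ k) 0)
  tail< (k>k′ ∷ decreasing′) =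
    <-≤-trans (binSum<2^[1+k] decreasing′) (≤-trans (^-monoʳ-≤ 2 k>k′) (m≤m+n (2 ^ k) 0))

tailSum≡widthFormula : ∀ k ks {x} → ⌈ k /2⌉ ≤ x → tailSum ℤ.+[1+ x ] (k ∷ ks) ≡ widthFormula (k ∷ ks)
tailSum≡widthFormula k ks ⌈k/2⌉≤x =
  cong (λ s → binomℤ k (ℤ.+ s) + tailSum (ℤ.+ s) ks) (m≤n⇒m⊓n≡m ⌈k/2⌉≤x)

-- Among n-bit ballot sequences that must end at height t, the largest layer is the one of
-- size ⌊(n − t)/2⌋; this cap on the level is where the minimum in s_i comes from.
BallotBound : ℕ → Set
BallotBound n = ∀ t ks → Linked _>_ (n ∷ ks) → t ≤ n →
                #ballots n (binSum ks) t ≤ tailSum ℤ.+[1+ ⌊ (n ∸ t) /2⌋ ] ks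

module _ {m : ℕ} (bound : BallotBound m) {t : ℕ} (t≤1+m : t ≤ suc m) where

  ballotBound-belowTop : ∀ {k ks} → k < m → Linked _>_ (k ∷ ks) →
    #ballots (suc m) (binSum (k ∷ ks)) t ≤ tailSum ℤ.+[1+ ⌊ (suc m ∸ t) /2⌋ ] (k ∷ ks)
  ballotBound-belowTop {k} {ks} k<m decreasing = begin
    #ballots (suc m) (binSum (k ∷ ks)) t
      ≡⟨ #ballots-below-top m t (<⇒≤ (<-≤-trans (binSum<2^[1+k] decreasing) (^-monoʳ-≤ 2 k<m))) ⟩
    #ballots m (binSum (k ∷ ks)) (t ∸ 1)
      ≤⟨ bound (t ∸ 1) (k ∷ ks) (k<m ∷ decreasing) (∸-monoˡ-≤ 1 t≤1+m) ⟩
    tailSum ℤ.+[1+ ⌊ (m ∸ (t ∸ 1)) /2⌋ ] (k ∷ ks)   ≡⟨ recap t ⟩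
    tailSum ℤ.+[1+ ⌊ (suc m ∸ t) /2⌋ ] (k ∷ ks)     ∎
    where
    open ≤-Reasoning
    recap : ∀ t → tailSum ℤ.+[1+ ⌊ (m ∸ (t ∸ 1)) /2⌋ ] (k ∷ ks) ≡
                  tailSum ℤ.+[1+ ⌊ (suc m ∸ t) /2⌋ ] (k ∷ ks)
    recap zero = trans (tailSum≡widthFormula k ks (⌊n/2⌋-mono k<m))
                   (sym (tailSum≡widthFormula k ks (⌊n/2⌋-mono (m≤n⇒m≤1+n k<m))))
    recap (suc t) = refl

  ballotBound-atTop : ∀ {ks} → Linked _>_ (m ∷ ks) →
    #ballots (suc m) (binSum (m ∷ ks)) t ≤ tailSum ℤ.+[1+ ⌊ (suc m ∸ t) /2⌋ ] (m ∷ ks)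
  ballotBound-atTop {ks} decreasing = begin
    #ballots (suc m) (2 ^ m + binSum ks) t                 ≡⟨ #ballots-with-top m (binSum ks) t ⟩
    #ballots m (2 ^ m) (t ∸ 1) + #ballots m (binSum ks) (suc t)
      ≡⟨ cong (_+ #ballots m (binSum ks) (suc t))
              (trans (#ballots-all m (t ∸ 1) (∸-monoˡ-≤ 1 t≤1+m)) (lowerLayer t)) ⟩
    m C s + #ballots m (binSum ks) (suc t)       ≤⟨ +-monoʳ-≤ (m C s) (upperPart (suc t ≤? m)) ⟩
    m C s + tailSum (ℤ.+ s) ks
      ≡⟨ cong (λ s′ → binomℤ m (ℤ.+ s′) + tailSum (ℤ.+ s′) ks)
              (m≥n⇒m⊓n≡n (⌊n/2⌋-mono (m∸n≤m (suc m) t))) ⟨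
    tailSum ℤ.+[1+ s ] (m ∷ ks)                             ∎
    where
    open ≤-Reasoning
    s = ⌊ (suc m ∸ t) /2⌋
    lowerLayer : ∀ t → m C ⌊ (m ∸ (t ∸ 1)) /2⌋ ≡ m C ⌊ (suc m ∸ t) /2⌋
    lowerLayer zero = nC⌊n/2⌋≡nC⌈n/2⌉ m
    lowerLayer (suc t) = refl
    upperPart : Dec (suc t ≤ m) → #ballots m (binSum ks) (suc t) ≤ tailSum (ℤ.+ s) ks
    upperPart (yes 1+t≤m) = subst (λ x → #ballots m (binSum ks) (suc t) ≤ tailSum (ℤ.+ ⌊ x /2⌋) ks)
      (sym (∸≡2+∸[2+] (suc m) t (s≤s 1+t≤m))) (bound (suc t) ks decreasing 1+t≤m)
    upperPart (no 1+t≰m) =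
      ≤-trans (≤-reflexive (#ballots-unreachable m (binSum ks) (suc t) (≰⇒> 1+t≰m))) z≤n

#ballots≤tailSum : ∀ n → BallotBound n
#ballots≤tailSum n t [] _ _ = ≤-reflexive (#ballots-empty n t)
#ballots≤tailSum (suc m) t (k ∷ ks) (k<1+m ∷ decreasing) t≤1+m with <-cmp k m
... | tri< k<m _ _ = ballotBound-belowTop (#ballots≤tailSum m) t≤1+m k<m decreasing
... | tri≈ _ refl _ = ballotBound-atTop (#ballots≤tailSum m) t≤1+m decreasing
... | tri> _ _ k>m = ⊥-elim (<⇒≱ k>m (≤-pred k<1+m))

top-exponent : ∀ n k ks → binSum (k ∷ ks) ≤ 2 ^ n → k < n ⊎ (k ≡ n × ks ≡ [])
top-exponent n k ks d≤2^n with <-cmp k n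
... | tri< k<n _ _ = inj₁ k<n
... | tri> _ _ k>n = ⊥-elim (<⇒≱ (^-monoʳ-< 2 (s≤s (s≤s z≤n)) k>n) (≤-trans (m≤m+n (2 ^ k) _) d≤2^n))
top-exponent n k [] _ | tri≈ _ k≡n _ = inj₂ (k≡n , refl)
top-exponent n k (k′ ∷ ks) d≤2^n | tri≈ _ refl _ =
  ⊥-elim (<⇒≱ (m<m+n (2 ^ k) (≤-trans (m^n>0 2 k′) (m≤m+n (2 ^ k′) _))) d≤2^n)

#ballots≤widthFormula : ∀ n k ks → Linked _>_ (k ∷ ks) → binSum (k ∷ ks) ≤ 2 ^ n →
                        #ballots n (binSum (k ∷ ks)) 0 ≤ widthFormula (k ∷ ks)
#ballots≤widthFormula n k ks decreasing d≤2^n with top-exponent n k ks d≤2^n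
... | inj₁ k<n =
  subst (#ballots n (binSum (k ∷ ks)) 0 ≤_) (tailSum≡widthFormula k ks (⌊n/2⌋-mono k<n))
    (#ballots≤tailSum n 0 (k ∷ ks) (k<n ∷ decreasing) z≤n)
... | inj₂ (refl , refl) = ≤-reflexive (begin
  #ballots k (2 ^ k + 0) 0    ≡⟨ #ballots-saturated k 0 (m≤m+n (2 ^ k) 0) ⟩
  #ballots k (2 ^ k) 0        ≡⟨ #ballots-all k 0 z≤n ⟩
  k C ⌊ k /2⌋                 ≡⟨ nC⌊n/2⌋≡nC⌈n/2⌉ k ⟩
  k C ⌈ k /2⌉                 ≡⟨ +-identityʳ _ ⟨
  widthFormula (k ∷ [])       ∎)
  where open ≡-Reasoning

module _ {m : ℕ} {P Q : Pred (Subset m) 0ℓ} (f g : Subset m → Subset n)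
         (incomparable : ∀ {A B} → P A → Q B → Incomparable (f A) (g B)) where

  antichain-map-++ : ∀ {As Bs} →
    AllPairs Incomparable (map f As) → AllPairs Incomparable (map g Bs) →
    All P As → All Q Bs → AllPairs Incomparable (map f As ++ map g Bs)
  antichain-map-++ antichainˡ antichainʳ Ps Qs = AllPairs.++⁺ antichainˡ antichainʳ
    (All.map⁺ (All.map (λ p → All.map⁺ (All.map (incomparable p) Qs)) Ps))

layer : (m s : ℕ) → List (Subset m)
layer zero zero = [] ∷ []
layer zero (suc s) = []
layer (suc m) zero = map (false ∷_) (layer m zero)
layer (suc m) (suc s) = map (false ∷_) (layer m (suc s)) ++ map (true ∷_) (layer m s)

length-layer : ∀ m s → length (layer m s) ≡ m C s
length-layer zero zero = refl
length-layer zero (suc s) = refl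
length-layer (suc m) zero = trans (length-map (false ∷_) (layer m zero)) (length-layer m zero)
length-layer (suc m) (suc s) = begin
  length (map (false ∷_) (layer m (suc s)) ++ map (true ∷_) (layer m s))
    ≡⟨ length-map-++-map (false ∷_) (true ∷_) (layer m (suc s)) (layer m s) ⟩
  length (layer m (suc s)) + length (layer m s)
    ≡⟨ cong₂ _+_ (length-layer m (suc s)) (length-layer m s) ⟩
  m C suc s + m C s                              ≡⟨ pascal m s ⟩
  suc m C suc s                                  ∎
  where open ≡-Reasoning

layer-size : ∀ m s → All (λ A → ∣ A ∣ ≡ s) (layer m s)
layer-size zero zero = refl ∷ []
layer-size zero (suc s) = []
layer-size (suc m) zero = All.map⁺ (layer-size m zero)
layer-size (suc m) (suc s) =
  All.++⁺ (All.map⁺ (layer-size m (suc s))) (All.map⁺ (All.map (cong suc) (layer-size m s)))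

layer-antichain : ∀ m s → AllPairs Incomparable (layer m s)
layer-antichain zero zero = [] ∷ []
layer-antichain zero (suc s) = []
layer-antichain (suc m) zero = antichain-map-∷ false (layer-antichain m zero)
layer-antichain (suc m) (suc s) =
  antichain-map-++ (false ∷_) (true ∷_) incomparable
    (antichain-map-∷ false (layer-antichain m (suc s)))
    (antichain-map-∷ true (layer-antichain m s))
    (layer-size m (suc s)) (layer-size m s)
  where
  incomparable : ∀ {A B} → ∣ A ∣ ≡ suc s → ∣ B ∣ ≡ s → Incomparable (false ∷ A) (true ∷ B)
  incomparable ∣A∣≡1+s ∣B∣≡s =
    (λ A⊆B → 1+n≰n (subst₂ _≤_ ∣A∣≡1+s ∣B∣≡s (p⊆q⇒∣p∣≤∣q∣ (drop-∷-⊆ A⊆B)))) ,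
    inside∷⊈outside∷

layerℤ : (m : ℕ) → ℤ → List (Subset m)
layerℤ m (ℤ.+ s) = layer m s
layerℤ m ℤ.-[1+ _ ] = []

length-layerℤ : ∀ m s → length (layerℤ m s) ≡ binomℤ m s
length-layerℤ m (ℤ.+ s) = length-layer m s
length-layerℤ m ℤ.-[1+ _ ] = refl

layerℤ-size : ∀ m s → All (λ A → ℤ.+ ∣ A ∣ ≡ s) (layerℤ m s)
layerℤ-size m (ℤ.+ s) = All.map (cong (λ x → ℤ.+ x)) (layer-size m s)
layerℤ-size m ℤ.-[1+ _ ] = []

layerℤ-antichain : ∀ m s → AllPairs Incomparable (layerℤ m s)
layerℤ-antichain m (ℤ.+ s) = layer-antichain m s
layerℤ-antichain m ℤ.-[1+ _ ] = []

nextLevel : ℕ → ℤ → ℤ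
nextLevel k p = ℤ.+ ⌈ k /2⌉ ℤ.⊓ (p ℤ.- ℤ.+ 1)

nextLevel< : ∀ k p → nextLevel k p ℤ.< p
nextLevel< k p = i≤j-1⇒i<j (ℤ.i⊓j≤j (ℤ.+ ⌈ k /2⌉) (p ℤ.- ℤ.+ 1))

family : (n : ℕ) → List ℕ → ℤ → List (Subset n)
family zero ks p = []
family (suc m) [] p = []
family (suc m) (k ∷ ks) p with k ≟ m
... | yes refl = map (_∷ʳ false) (layerℤ k s) ++ map (_∷ʳ true) (family k ks s)
  where s = nextLevel k p
... | no _ = map (_∷ʳ false) (family m (k ∷ ks) p)

length-family : ∀ n ks p → Linked _>_ (n ∷ ks) → length (family n ks p) ≡ tailSum p ks
length-family zero [] p _ = refl
length-family zero (k ∷ ks) p (() ∷ _)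
length-family (suc m) [] p _ = refl
length-family (suc m) (k ∷ ks) p (k<1+m ∷ decreasing) with k ≟ m
... | yes refl = trans (length-map-++-map (_∷ʳ false) (_∷ʳ true) (layerℤ k s) (family k ks s))
      (cong₂ _+_ (length-layerℤ k s) (length-family k ks s decreasing))
  where s = nextLevel k p
... | no k≢m = trans (length-map (_∷ʳ false) (family m (k ∷ ks) p))
      (length-family m (k ∷ ks) p (≤∧≢⇒< (≤-pred k<1+m) k≢m ∷ decreasing))

family-values : ∀ n ks p → Linked _>_ (n ∷ ks) → All (λ X → value X < binSum ks) (family n ks p)
family-values zero [] p _ = []
family-values zero (k ∷ ks) p (() ∷ _)
family-values (suc m) [] p _ = []
family-values (suc m) (k ∷ ks) p (k<1+m ∷ decreasing) with k ≟ m
... | yes refl = All.++⁺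
      (All.map⁺ {f = _∷ʳ false} (All.universal lower _))
      (All.map⁺ {f = _∷ʳ true} (All.map (λ {X} → upper X) (family-values k ks _ decreasing)))
  where
  lower : ∀ X → value (X ∷ʳ false) < 2 ^ k + binSum ks
  lower X = subst (_< _) (sym (value-∷ʳfalse X)) (<-≤-trans (value<2^n X) (m≤m+n (2 ^ k) _))
  upper : ∀ X → value X < binSum ks → value (X ∷ʳ true) < 2 ^ k + binSum ks
  upper X X<d′ =
    subst₂ _<_ (sym (value-∷ʳtrue X)) (+-comm (binSum ks) (2 ^ k)) (+-monoˡ-< (2 ^ k) X<d′)
... | no k≢m = All.map⁺ {f = _∷ʳ false}
      (All.map (λ {X} X<d → subst (_< binSum (k ∷ ks)) (sym (value-∷ʳfalse X)) X<d)
      (family-values m (k ∷ ks) p (≤∧≢⇒< (≤-pred k<1+m) k≢m ∷ decreasing)))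

family-size : ∀ n ks p → All (λ X → ℤ.+ ∣ X ∣ ℤ.< p) (family n ks p)
family-size zero ks p = []
family-size (suc m) [] p = []
family-size (suc m) (k ∷ ks) p with k ≟ m
... | yes refl = All.++⁺
      (All.map⁺ {f = _∷ʳ false} (All.map (λ {X} → lower X) (layerℤ-size k (nextLevel k p))))
      (All.map⁺ {f = _∷ʳ true} (All.map (λ {X} → upper X) (family-size k ks (nextLevel k p))))
  where
  lower : ∀ X → ℤ.+ ∣ X ∣ ≡ nextLevel k p → ℤ.+ ∣ X ∷ʳ false ∣ ℤ.< p
  lower X ∣X∣≡s = subst (λ x → ℤ.+ x ℤ.< p) (sym (∣p∷ʳfalse∣≡∣p∣ X))
                    (subst (ℤ._< p) (sym ∣X∣≡s) (nextLevel< k p))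
  upper : ∀ X → ℤ.+ ∣ X ∣ ℤ.< nextLevel k p → ℤ.+ ∣ X ∷ʳ true ∣ ℤ.< p
  upper X ∣X∣<s = subst (λ x → ℤ.+ x ℤ.< p) (sym (∣p∷ʳtrue∣≡1+∣p∣ X))
                      (ℤ.≤-<-trans (ℤ.i<j⇒suc[i]≤j ∣X∣<s) (nextLevel< k p))
... | no _ = All.map⁺ {f = _∷ʳ false}
      (All.map (λ {X} ∣X∣<p → subst (λ x → ℤ.+ x ℤ.< p) (sym (∣p∷ʳfalse∣≡∣p∣ X)) ∣X∣<p)
      (family-size m (k ∷ ks) p))

family-antichain : ∀ n ks p → AllPairs Incomparable (family n ks p)
family-antichain zero ks p = []
family-antichain (suc m) [] p = []
family-antichain (suc m) (k ∷ ks) p with k ≟ m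
... | yes refl = antichain-map-++ (_∷ʳ false) (_∷ʳ true) incomparable
      (antichain-map-∷ʳ false (layerℤ-antichain k s))
      (antichain-map-∷ʳ true (family-antichain k ks s))
      (layerℤ-size k s) (family-size k ks s)
  where
  s = nextLevel k p
  incomparable : ∀ {A B} → ℤ.+ ∣ A ∣ ≡ s → ℤ.+ ∣ B ∣ ℤ.< s → Incomparable (A ∷ʳ false) (B ∷ʳ true)
  incomparable {A} {B} ∣A∣≡s ∣B∣<s =
    (λ A⊆B → ℤ.<-irrefl refl (subst (ℤ.+ ∣ A ∣ ℤ.<_) (sym ∣A∣≡s)
               (ℤ.≤-<-trans (ℤ.+≤+ (p⊆q⇒∣p∣≤∣q∣ (∷ʳ-⊆⁻ A⊆B))) ∣B∣<s))) ,
    ∷ʳinside⊈∷ʳoutside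
... | no _ = antichain-map-∷ʳ false (family-antichain m (k ∷ ks) p)

width-upper : ∀ n k ks → Linked _>_ (k ∷ ks) → binSum (k ∷ ks) ≤ 2 ^ n →
              (L : List (Subset n)) → IsAntichainInC (binSum (k ∷ ks)) L →
              length L ≤ widthFormula (k ∷ ks)
width-upper n k ks decreasing d≤2^n L antichainInC =
  let antichain , values = IsAntichainInC⇒ antichainInC in
  ≤-trans (antichain≤#ballots _ L antichain values) (#ballots≤widthFormula n k ks decreasing d≤2^n)

width-lower : ∀ n k ks → Linked _>_ (k ∷ ks) → binSum (k ∷ ks) ≤ 2 ^ n →
              ∃ λ (L : List (Subset n)) →
                IsAntichainInC (binSum (k ∷ ks)) L × length L ≡ widthFormula (k ∷ ks)
width-lower n k ks decreasing d≤2^n with top-exponent n k ks d≤2^n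
... | inj₁ k<n =
  family n (k ∷ ks) p ,
  ⇒IsAntichainInC (family-antichain n (k ∷ ks) p) (family-values n (k ∷ ks) p (k<n ∷ decreasing)) ,
  trans (length-family n (k ∷ ks) p (k<n ∷ decreasing)) (tailSum≡widthFormula k ks ≤-refl)
  where p = ℤ.+[1+ ⌈ k /2⌉ ]
... | inj₂ (refl , refl) =
  layer k ⌈ k /2⌉ ,
  ⇒IsAntichainInC (layer-antichain k ⌈ k /2⌉)
    (All.universal (λ A → subst (value A <_) (sym (+-identityʳ _)) (value<2^n A)) _) ,
  trans (length-layer k ⌈ k /2⌉) (sym (+-identityʳ _))

proposition9 : (d : ℕ) → 0 < d → (ks : List ℕ) → Linked _>_ ks → d ≡ binSum ks →
    (n : ℕ) → d ≤ 2 ^ n → WidthC n d (widthFormula ks)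
proposition9 d 0<d [] _ refl n _ = ⊥-elim (<-irrefl refl 0<d)
proposition9 d _ (k ∷ ks) decreasing refl n d≤2^n =
  width-lower n k ks decreasing d≤2^n , width-upper n k ks decreasing d≤2^n
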